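{- Let $m\geq1$ be an integer and let $\mathfrak f$ be any of the eight entries $\mathfrak a_0,\mathfrak b_0,\mathfrak c_0,\mathfrak d_0,\mathfrak a_1,\mathfrak b_1,\mathfrak c_1,\mathfrak d_1$, where \[M_0^m=\begin{pmatrix}\mathfrak a_0(x)&\mathfrak b_0(x)\\\mathfrak c_0(x)&\mathfrak d_0(x)\end{pmatrix},\qquad M_1^m=\begin{pmatrix}\mathfrak a_1(x)&\mathfrak b_1(x)\\\mathfrak c_1(x)&\mathfrak d_1(x)\end{pmatrix}.\] Then for every integer $k\geq1$, the coefficient of $x^k$ in the power series of $\mathfrak f$ satisfies \[[x^k]\,\mathfrak f(x)\leq\frac{2}{(\log 2)^k}.\]
   Context: Let $C(x)=\cosh x$ and $S(x)=\sinh x$. Define the $2\times2$ matrices of entire functions \[A_0=\begin{pmatrix}C(x)&S(x)\\-C(x)&-S(x)\end{pmatrix},\ B_0=\begin{pmatrix}1&1\\1&1\end{pmatrix},\ A_1=\begin{pmatrix}C(x)&S(x)\\C(x)&S(x)\end{pmatrix},\ B_1=\begin{pmatrix}1&-1\\-1&1\end{pmatrix},\] and $M_0=\frac12(A_0+B_0)$, $M_1=\frac12(A_1+B_1)$. $[x^k]f$ denotes the coefficient of $x^k$ in the Taylor expansion of $f$ at $0$. -}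

module Defs where

open import Data.Nat as ℕ using (ℕ; zero; suc; _!; _∸_)
open import Data.Nat.Properties using (_!≢0)
open import Data.Integer using (+_)
open import Data.Rational using (ℚ; 0ℚ; 1ℚ; ½; _+_; _*_; _-_; -_; _/_; _≤_)
open import Data.Fin using (Fin; zero; suc)
open import Data.Bool using (Bool; true; false; if_then_else_)

PS : Set
PS = ℕ → ℚ

isEven : ℕ → Bool
isEven zero = true
isEven (suc zero) = false
isEven (suc (suc n)) = isEven n

inv! : ℕ → ℚ
inv! n = (+ 1 / (n !)) {{n !≢0}}

coshPS : PS
coshPS n = if isEven n then inv! n else 0ℚ

sinhPS : PS
sinhPS n = if isEven n then 0ℚ else inv! n

onePS : PS
onePS zero = 1ℚ
onePS (suc _) = 0ℚ

zeroPS : PS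
zeroPS _ = 0ℚ

_⊕_ : PS → PS → PS
(f ⊕ g) n = f n + g n

negPS : PS → PS
negPS f n = - f n

scalePS : ℚ → PS → PS
scalePS c f n = c * f n

sumTo : ℕ → (ℕ → ℚ) → ℚ
sumTo zero h = h zero
sumTo (suc n) h = sumTo n h + h (suc n)

_⊛_ : PS → PS → PS
(f ⊛ g) n = sumTo n (λ i → f i * g (n ∸ i))

Mat : Set
Mat = Fin 2 → Fin 2 → PS

mat : PS → PS → PS → PS → Mat
mat a b c d zero zero = a
mat a b c d zero (suc zero) = b
mat a b c d (suc zero) zero = c
mat a b c d (suc zero) (suc zero) = d

_+M_ : Mat → Mat → Mat
(A +M B) i j = A i j ⊕ B i j

halfM : Mat → Mat
halfM A i j = scalePS ½ (A i j)

_*M_ : Mat → Mat → Mat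
(A *M B) i j = (A i zero ⊛ B zero j) ⊕ (A i (suc zero) ⊛ B (suc zero) j)

idM : Mat
idM = mat onePS zeroPS zeroPS onePS

_^M_ : Mat → ℕ → Mat
M ^M zero = idM
M ^M suc m = M *M (M ^M m)

A₀ B₀ A₁ B₁ M₀ M₁ : Mat
A₀ = mat coshPS sinhPS (negPS coshPS) (negPS sinhPS)
B₀ = mat onePS onePS onePS onePS
A₁ = mat coshPS sinhPS coshPS sinhPS
B₁ = mat onePS (negPS onePS) (negPS onePS) onePS
M₀ = halfM (A₀ +M B₀)
M₁ = halfM (A₁ +M B₁)

Mb : Fin 2 → Mat
Mb zero = M₀
Mb (suc zero) = M₁

_^ℚ_ : ℚ → ℕ → ℚ
q ^ℚ zero = 1ℚ
q ^ℚ suc n = q * (q ^ℚ n)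

expPartial : ℚ → ℕ → ℚ
expPartial l N = sumTo N (λ n → (l ^ℚ n) * inv! n)

-- For 0 < l: l ≤ log 2  ⇔  exp l ≤ 2  ⇔  every partial sum of exp l is ≤ 2.
-- (This is the Dedekind lower cut of the real number log 2.)
≤log2 : ℚ → Set
≤log2 l = ∀ N → expPartial l N ≤ (+ 2 / 1)

{-# OPTIONS --safe #-}
-- Choose σ, τ ∈ ℚ² with M σ = a σ and M τ = τ + c σ, where {a, c} = {½eˣ, ½e⁻ˣ}.  Then
-- every column of M^m is σ p_m + τ r for a constant r with |r| ≤ ½, and p_{m+1} = a p_m + r c.
-- Write ‖f‖_k = |[x^k] f| l^k.  As ‖a‖_k, ‖c‖_k ≤ ½ l^k/k!, induction on m gives ‖p_m‖_0 ≤ ½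
-- and ‖p_m‖_k ≤ 2 for k ≥ 1: the recursion bounds ‖p_{m+1}‖_k by Σ_{i<k} l^i/i! + ½ l^k/k!,
-- which is below a partial sum of exp l ≤ 2.  The entries of σ and τ are ±1, so the entries
-- of M^m obey the same bound in positive degree.
module Submission where

open import Defs
open import Data.Nat using (ℕ; _≥_)
open import Data.Fin using (Fin)
open import Data.Integer using (+_)
open import Data.Rational using (ℚ; 0ℚ; _<_; _≤_; _*_; _/_)

open import Algebra.Bundles using (CommutativeMonoid)
open import Data.Bool using (true; false)
open import Data.Fin using (zero; suc)
open import Data.Integer using (-[1+_])
open import Data.Nat using (zero; suc; _∸_)
import Data.Nat as ℕ
import Data.Nat.Properties as ℕₚ
open import Data.Rational using (mkℚ; 1ℚ; ½; _+_; -_; _-_; ∣_∣; _≤?_; nonNegative)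
open import Data.Rational.Properties
open import Data.Rational.Solver using (module +-*-Solver)
open import Data.Vec.Functional using ([]; _∷_)
open import Relation.Binary.PropositionalEquality
open import Relation.Nullary.Decidable using (from-yes)

open +-*-Solver using (solve; _:=_; _:+_; _:*_; _:-_; :-_; con)
open import Algebra.Properties.CommutativeSemigroup
  (CommutativeMonoid.commutativeSemigroup +-0-commutativeMonoid)
  using () renaming (interchange to +-interchange)
open import Algebra.Properties.CommutativeSemigroup
  (CommutativeMonoid.commutativeSemigroup *-1-commutativeMonoid)
  using () renaming (interchange to *-interchange)

*-nonNeg : ∀ {p q} → 0ℚ ≤ p → 0ℚ ≤ q → 0ℚ ≤ p * q
*-nonNeg {p} {q} 0≤p 0≤q =
  nonNegative⁻¹ (p * q) {{nonNeg*nonNeg⇒nonNeg p {{nonNegative 0≤p}} q {{nonNegative 0≤q}}}}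

*-mono-≤-nonNeg : ∀ {p q r s} → 0ℚ ≤ q → 0ℚ ≤ r → p ≤ q → r ≤ s → p * r ≤ q * s
*-mono-≤-nonNeg {q = q} {r} 0≤q 0≤r p≤q r≤s =
  ≤-trans (*-monoʳ-≤-nonNeg r {{nonNegative 0≤r}} p≤q) (*-monoˡ-≤-nonNeg q {{nonNegative 0≤q}} r≤s)

p≤∣p∣ : ∀ p → p ≤ ∣ p ∣
p≤∣p∣ (mkℚ (+ _) _ _) = ≤-refl
p≤∣p∣ p@(mkℚ -[1+ _ ] _ _) = ≤-trans (<⇒≤ (negative⁻¹ p)) (0≤∣p∣ p)

½*p≤p : ∀ {p} → 0ℚ ≤ p → ½ * p ≤ p
½*p≤p {p} 0≤p =
  ≤-trans (*-monoʳ-≤-nonNeg p {{nonNegative 0≤p}} (from-yes (½ ≤? 1ℚ))) (≤-reflexive (*-identityˡ p))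

^ℚ-nonNeg : ∀ {l} → 0ℚ ≤ l → ∀ k → 0ℚ ≤ l ^ℚ k
^ℚ-nonNeg 0≤l zero = from-yes (0ℚ ≤? 1ℚ)
^ℚ-nonNeg 0≤l (suc k) = *-nonNeg 0≤l (^ℚ-nonNeg 0≤l k)

^ℚ-+ : ∀ l m n → l ^ℚ (m ℕ.+ n) ≡ l ^ℚ m * l ^ℚ n
^ℚ-+ l zero n = sym (*-identityˡ (l ^ℚ n))
^ℚ-+ l (suc m) n = trans (cong (l *_) (^ℚ-+ l m n)) (sym (*-assoc l (l ^ℚ m) (l ^ℚ n)))

^ℚ-split : ∀ l {i k} → i ℕ.≤ k → l ^ℚ k ≡ l ^ℚ i * l ^ℚ (k ∸ i)
^ℚ-split l {i} {k} i≤k = trans (cong (l ^ℚ_) (sym (ℕₚ.m+[n∸m]≡n i≤k))) (^ℚ-+ l i (k ∸ i))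

inv!-nonNeg : ∀ n → 0ℚ ≤ inv! n
inv!-nonNeg n = nonNegative⁻¹ (inv! n) {{normalize-nonNeg 1 (n ℕ.!) {{n ℕₚ.!≢0}}}}

expTerm : ℚ → PS
expTerm l k = l ^ℚ k * inv! k

expTerm-nonNeg : ∀ {l} → 0ℚ ≤ l → ∀ k → 0ℚ ≤ expTerm l k
expTerm-nonNeg 0≤l k = *-nonNeg (^ℚ-nonNeg 0≤l k) (inv!-nonNeg k)

sumTo-cong : ∀ n {f g : ℕ → ℚ} → (∀ i → i ℕ.≤ n → f i ≡ g i) → sumTo n f ≡ sumTo n g
sumTo-cong zero f≡g = f≡g 0 ℕ.z≤n
sumTo-cong (suc n) f≡g =
  cong₂ _+_ (sumTo-cong n (λ i i≤n → f≡g i (ℕₚ.m≤n⇒m≤1+n i≤n))) (f≡g (suc n) ℕₚ.≤-refl)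

sumTo-mono-≤ : ∀ n {f g : ℕ → ℚ} → (∀ i → i ℕ.≤ n → f i ≤ g i) → sumTo n f ≤ sumTo n g
sumTo-mono-≤ zero f≤g = f≤g 0 ℕ.z≤n
sumTo-mono-≤ (suc n) f≤g =
  +-mono-≤ (sumTo-mono-≤ n (λ i i≤n → f≤g i (ℕₚ.m≤n⇒m≤1+n i≤n))) (f≤g (suc n) ℕₚ.≤-refl)

sumTo-+ : ∀ n (f g : ℕ → ℚ) → sumTo n (λ i → f i + g i) ≡ sumTo n f + sumTo n g
sumTo-+ zero f g = refl
sumTo-+ (suc n) f g =
  trans (cong (_+ (f (suc n) + g (suc n))) (sumTo-+ n f g)) (+-interchange (sumTo n f) (sumTo n g) (f (suc n)) (g (suc n)))

*-distribˡ-sumTo : ∀ n c (f : ℕ → ℚ) → c * sumTo n f ≡ sumTo n (λ i → c * f i)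
*-distribˡ-sumTo zero c f = refl
*-distribˡ-sumTo (suc n) c f =
  trans (*-distribˡ-+ c (sumTo n f) (f (suc n))) (cong (_+ c * f (suc n)) (*-distribˡ-sumTo n c f))

*-distribʳ-sumTo : ∀ n c (f : ℕ → ℚ) → sumTo n f * c ≡ sumTo n (λ i → f i * c)
*-distribʳ-sumTo zero c f = refl
*-distribʳ-sumTo (suc n) c f =
  trans (*-distribʳ-+ c (sumTo n f) (f (suc n))) (cong (_+ f (suc n) * c) (*-distribʳ-sumTo n c f))

∣sumTo∣≤sumTo∣∣ : ∀ n (f : ℕ → ℚ) → ∣ sumTo n f ∣ ≤ sumTo n (λ i → ∣ f i ∣)
∣sumTo∣≤sumTo∣∣ zero f = ≤-refl
∣sumTo∣≤sumTo∣∣ (suc n) f =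
  ≤-trans (∣p+q∣≤∣p∣+∣q∣ (sumTo n f) (f (suc n))) (+-monoˡ-≤ ∣ f (suc n) ∣ (∣sumTo∣≤sumTo∣∣ n f))

sumTo-head : ∀ n {f : ℕ → ℚ} → (∀ i → f (suc i) ≡ 0ℚ) → sumTo n f ≡ f 0
sumTo-head zero _ = refl
sumTo-head (suc n) {f} f⁺≡0 = trans (cong₂ _+_ (sumTo-head n f⁺≡0) (f⁺≡0 n)) (+-identityʳ (f 0))

⊛-congʳ : ∀ f {g h} → g ≗ h → f ⊛ g ≗ f ⊛ h
⊛-congʳ f g≗h n = sumTo-cong n (λ i _ → cong (f i *_) (g≗h (n ∸ i)))

⊛-identityˡ : ∀ f → onePS ⊛ f ≗ f
⊛-identityˡ f n = trans (sumTo-head n (λ i → *-zeroˡ (f (n ∸ suc i)))) (*-identityˡ (f n))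

⊛-distribˡ-⊕ : ∀ f g h → f ⊛ (g ⊕ h) ≗ (f ⊛ g) ⊕ (f ⊛ h)
⊛-distribˡ-⊕ f g h n =
  trans (sumTo-cong n (λ i _ → *-distribˡ-+ (f i) (g (n ∸ i)) (h (n ∸ i))))
        (sumTo-+ n (λ i → f i * g (n ∸ i)) (λ i → f i * h (n ∸ i)))

⊛-suc : ∀ f g k → (f ⊛ g) (suc k) ≡ sumTo k (λ i → f i * g (suc (k ∸ i))) + f (suc k) * g 0
⊛-suc f g k = cong₂ _+_
  (sumTo-cong k (λ i i≤k → cong (λ n → f i * g n) (ℕₚ.+-∸-assoc 1 i≤k)))
  (cong (λ n → f (suc k) * g n) (ℕₚ.n∸n≡0 k))

constPS : ℚ → PS
constPS r = scalePS r onePS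

record Majorised (l : ℚ) (f F : PS) : Set where
  constructor majorised
  field
    bound : ∀ k → ∣ f k ∣ * l ^ℚ k ≤ F k

Majorised-resp-≗ : ∀ {l f g F} → f ≗ g → Majorised l g F → Majorised l f F
Majorised-resp-≗ {l} {F = F} f≗g (majorised g≤F) =
  majorised λ k → subst (λ x → ∣ x ∣ * l ^ℚ k ≤ F k) (sym (f≗g k)) (g≤F k)

Majorised-mono : ∀ {l f F G} → Majorised l f F → (∀ k → F k ≤ G k) → Majorised l f G
Majorised-mono (majorised f≤F) F≤G = majorised λ k → ≤-trans (f≤F k) (F≤G k)

constPS-majorised : ∀ {l r s} → ∣ r ∣ ≤ s → Majorised l (constPS r) (constPS s)
constPS-majorised {l} {r} {s} ∣r∣≤s = majorised bound
  where
  bound : ∀ k → ∣ r * onePS k ∣ * l ^ℚ k ≤ s * onePS k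
  bound zero = begin
    ∣ r * 1ℚ ∣ * 1ℚ ≡⟨ *-identityʳ ∣ r * 1ℚ ∣ ⟩
    ∣ r * 1ℚ ∣      ≡⟨ cong ∣_∣ (*-identityʳ r) ⟩
    ∣ r ∣           ≤⟨ ∣r∣≤s ⟩
    s               ≡⟨ *-identityʳ s ⟨
    s * 1ℚ          ∎
    where open ≤-Reasoning
  bound (suc k) = ≤-reflexive (begin
    ∣ r * 0ℚ ∣ * l ^ℚ suc k ≡⟨ cong (λ x → ∣ x ∣ * l ^ℚ suc k) (*-zeroʳ r) ⟩
    0ℚ * l ^ℚ suc k         ≡⟨ *-zeroˡ (l ^ℚ suc k) ⟩
    0ℚ                      ≡⟨ *-zeroʳ s ⟨
    s * 0ℚ                  ∎)
    where open ≡-Reasoning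

module _ {l : ℚ} (0≤l : 0ℚ ≤ l) where

  private
    L : ℕ → ℚ
    L k = l ^ℚ k

    *L-mono : ∀ k {p q} → p ≤ q → p * L k ≤ q * L k
    *L-mono k = *-monoʳ-≤-nonNeg (L k) {{nonNegative (^ℚ-nonNeg 0≤l k)}}

    ∣∣*L-nonNeg : ∀ x k → 0ℚ ≤ ∣ x ∣ * L k
    ∣∣*L-nonNeg x k = *-nonNeg (0≤∣p∣ x) (^ℚ-nonNeg 0≤l k)

  ⊕-majorised : ∀ {f g F G} → Majorised l f F → Majorised l g G → Majorised l (f ⊕ g) (F ⊕ G)
  ⊕-majorised {f} {g} {F} {G} (majorised f≤F) (majorised g≤G) = majorised λ k → begin
    ∣ f k + g k ∣ * L k           ≤⟨ *L-mono k (∣p+q∣≤∣p∣+∣q∣ (f k) (g k)) ⟩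
    (∣ f k ∣ + ∣ g k ∣) * L k     ≡⟨ *-distribʳ-+ (L k) ∣ f k ∣ ∣ g k ∣ ⟩
    ∣ f k ∣ * L k + ∣ g k ∣ * L k ≤⟨ +-mono-≤ (f≤F k) (g≤G k) ⟩
    F k + G k                     ∎
    where open ≤-Reasoning

  scalePS-majorised : ∀ {s f F} → ∣ s ∣ ≤ 1ℚ → Majorised l f F → Majorised l (scalePS s f) F
  scalePS-majorised {s} {f} {F} ∣s∣≤1 (majorised f≤F) = majorised λ k → begin
    ∣ s * f k ∣ * L k       ≡⟨ cong (_* L k) (∣p*q∣≡∣p∣*∣q∣ s (f k)) ⟩
    ∣ s ∣ * ∣ f k ∣ * L k   ≡⟨ *-assoc ∣ s ∣ ∣ f k ∣ (L k) ⟩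
    ∣ s ∣ * (∣ f k ∣ * L k) ≤⟨ *-mono-≤-nonNeg (from-yes (0ℚ ≤? 1ℚ)) (∣∣*L-nonNeg (f k) k) ∣s∣≤1 (f≤F k) ⟩
    1ℚ * F k                ≡⟨ *-identityˡ (F k) ⟩
    F k                     ∎
    where open ≤-Reasoning

  ⊛-majorised : ∀ {f g F G} → Majorised l f F → Majorised l g G → Majorised l (f ⊛ g) (F ⊛ G)
  ⊛-majorised {f} {g} {F} {G} (majorised f≤F) (majorised g≤G) = majorised λ k → begin
    ∣ (f ⊛ g) k ∣ * L k                       ≤⟨ *L-mono k (∣sumTo∣≤sumTo∣∣ k (λ i → f i * g (k ∸ i))) ⟩
    sumTo k (λ i → ∣ f i * g (k ∸ i) ∣) * L k ≡⟨ *-distribʳ-sumTo k (L k) (λ i → ∣ f i * g (k ∸ i) ∣) ⟩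
    sumTo k (λ i → ∣ f i * g (k ∸ i) ∣ * L k) ≤⟨ sumTo-mono-≤ k (term k) ⟩
    (F ⊛ G) k                                 ∎
    where
    open ≤-Reasoning
    term : ∀ k i → i ℕ.≤ k → ∣ f i * g (k ∸ i) ∣ * L k ≤ F i * G (k ∸ i)
    term k i i≤k = begin
      ∣ f i * g (k ∸ i) ∣ * L k
        ≡⟨ cong₂ _*_ (∣p*q∣≡∣p∣*∣q∣ (f i) (g (k ∸ i))) (^ℚ-split l i≤k) ⟩
      (∣ f i ∣ * ∣ g (k ∸ i) ∣) * (L i * L (k ∸ i))
        ≡⟨ *-interchange ∣ f i ∣ ∣ g (k ∸ i) ∣ (L i) (L (k ∸ i)) ⟩
      (∣ f i ∣ * L i) * (∣ g (k ∸ i) ∣ * L (k ∸ i))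
        ≤⟨ *-mono-≤-nonNeg (≤-trans (∣∣*L-nonNeg (f i) i) (f≤F i)) (∣∣*L-nonNeg (g (k ∸ i)) (k ∸ i))
                           (f≤F i) (g≤G (k ∸ i)) ⟩
      F i * G (k ∸ i) ∎

  expTerm-majorised : ∀ {s a} → (∀ k → ∣ a k ∣ ≤ s * inv! k) → Majorised l a (scalePS s (expTerm l))
  expTerm-majorised {s} {a} ∣a∣≤ = majorised λ k → begin
    ∣ a k ∣ * L k      ≤⟨ *L-mono k (∣a∣≤ k) ⟩
    s * inv! k * L k   ≡⟨ solve 3 (λ s i w → s :* i :* w := s :* (w :* i)) refl s (inv! k) (L k) ⟩
    s * (L k * inv! k) ∎
    where open ≤-Reasoning

envelope : PS
envelope zero = ½
envelope (suc _) = + 2 / 1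

constPS-½≤envelope : ∀ k → constPS ½ k ≤ envelope k
constPS-½≤envelope zero = ≤-refl
constPS-½≤envelope (suc k) = from-yes (0ℚ ≤? + 2 / 1)

envelope-step : ∀ {l} → 0ℚ ≤ l → ≤log2 l →
  ∀ k → (scalePS ½ (expTerm l) ⊛ (envelope ⊕ constPS ½)) k ≤ envelope k
envelope-step _ _ zero = ≤-refl
envelope-step {l} 0≤l l≤log2 (suc k) = begin
  (scalePS ½ (expTerm l) ⊛ (envelope ⊕ constPS ½)) (suc k)
    ≡⟨ ⊛-suc (scalePS ½ (expTerm l)) (envelope ⊕ constPS ½) k ⟩
  sumTo k (λ i → ½ * expTerm l i * (+ 2 / 1)) + ½ * expTerm l (suc k) * 1ℚ
    ≡⟨ cong₂ _+_ (sumTo-cong k (λ i _ → ½*x*2≡x (expTerm l i))) (*-identityʳ (½ * expTerm l (suc k))) ⟩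
  sumTo k (expTerm l) + ½ * expTerm l (suc k)
    ≤⟨ +-monoʳ-≤ (sumTo k (expTerm l)) (½*p≤p (expTerm-nonNeg 0≤l (suc k))) ⟩
  expPartial l (suc k)
    ≤⟨ l≤log2 (suc k) ⟩
  + 2 / 1 ∎
  where
  open ≤-Reasoning
  ½*x*2≡x : ∀ x → ½ * x * (+ 2 / 1) ≡ x
  ½*x*2≡x = solve 1 (λ x → con ½ :* x :* con (+ 2 / 1) := x) refl

Col : Set
Col = Fin 2 → PS

column : Mat → Fin 2 → Col
column M j i = M i j

infixr 7 _⊗_
infixl 6 _⊕ᶜ_

_⊗_ : (Fin 2 → ℚ) → PS → Col
(v ⊗ p) i = scalePS (v i) p

_⊕ᶜ_ : Col → Col → Col
(X ⊕ᶜ Y) i = X i ⊕ Y i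

_▹_ : Mat → Col → Col
(M ▹ X) i = (M i zero ⊛ X zero) ⊕ (M i (suc zero) ⊛ X (suc zero))

_⋆_ : Mat → (Fin 2 → ℚ) → Col
(M ⋆ v) i k = M i zero k * v zero + M i (suc zero) k * v (suc zero)

▹-cong : ∀ M {X Y} → (∀ i → X i ≗ Y i) → ∀ i → (M ▹ X) i ≗ (M ▹ Y) i
▹-cong M X≗Y i n =
  cong₂ _+_ (⊛-congʳ (M i zero) (X≗Y zero) n) (⊛-congʳ (M i (suc zero)) (X≗Y (suc zero)) n)

-- In the basis (σ, τ) of ℚ², M acts as the triangular matrix [[a, c], [0, 1]] of power
-- series; π j and ρ j are the coordinates of the j-th unit vector in that basis.
record Triangularisation (M : Mat) : Set where
  field
    σ τ : Fin 2 → ℚ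
    a c : PS
    σ-eigen : ∀ i k → (M ⋆ σ) i k ≡ σ i * a k
    τ-shear : ∀ i k → (M ⋆ τ) i k ≡ σ i * c k + τ i * onePS k
    π ρ : Fin 2 → ℚ
    idM-column : ∀ j i → column idM j i ≗ (σ ⊗ constPS (π j) ⊕ᶜ τ ⊗ constPS (ρ j)) i

module _ {M : Mat} (T : Triangularisation M) where
  open Triangularisation T

  ▹-triangular : ∀ p q i → (M ▹ (σ ⊗ p ⊕ᶜ τ ⊗ q)) i ≗ (σ ⊗ ((a ⊛ p) ⊕ (c ⊛ q)) ⊕ᶜ τ ⊗ q) i
  ▹-triangular p q i n = begin
    (M ▹ X) i n
      ≡⟨ sumTo-+ n (λ t → M i zero t * X zero (n ∸ t)) (λ t → M i (suc zero) t * X (suc zero) (n ∸ t)) ⟨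
    sumTo n (λ t → M i zero t * X zero (n ∸ t) + M i (suc zero) t * X (suc zero) (n ∸ t))
      ≡⟨ sumTo-cong n (λ t _ → term t) ⟩
    sumTo n (λ t → σ i * A t + τ i * (onePS t * q (n ∸ t)))
      ≡⟨ sumTo-+ n (λ t → σ i * A t) (λ t → τ i * (onePS t * q (n ∸ t))) ⟩
    sumTo n (λ t → σ i * A t) + sumTo n (λ t → τ i * (onePS t * q (n ∸ t)))
      ≡⟨ cong₂ _+_ (*-distribˡ-sumTo n (σ i) A) (*-distribˡ-sumTo n (τ i) (λ t → onePS t * q (n ∸ t))) ⟨
    σ i * sumTo n A + τ i * (onePS ⊛ q) n
      ≡⟨ cong₂ (λ x y → σ i * x + τ i * y)
               (sumTo-+ n (λ t → a t * p (n ∸ t)) (λ t → c t * q (n ∸ t))) (⊛-identityˡ q n) ⟩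
    σ i * ((a ⊛ p) n + (c ⊛ q) n) + τ i * q n ∎
    where
    open ≡-Reasoning
    X : Col
    X = σ ⊗ p ⊕ᶜ τ ⊗ q
    A : ℕ → ℚ
    A t = a t * p (n ∸ t) + c t * q (n ∸ t)
    term : ∀ t → M i zero t * X zero (n ∸ t) + M i (suc zero) t * X (suc zero) (n ∸ t)
               ≡ σ i * A t + τ i * (onePS t * q (n ∸ t))
    term t = begin
      M i zero t * X zero (n ∸ t) + M i (suc zero) t * X (suc zero) (n ∸ t)
        ≡⟨ solve 8 (λ m₀ m₁ s₀ s₁ t₀ t₁ P Q →
             m₀ :* (s₀ :* P :+ t₀ :* Q) :+ m₁ :* (s₁ :* P :+ t₁ :* Q)
               := (m₀ :* s₀ :+ m₁ :* s₁) :* P :+ (m₀ :* t₀ :+ m₁ :* t₁) :* Q)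
             refl (M i zero t) (M i (suc zero) t) (σ zero) (σ (suc zero)) (τ zero) (τ (suc zero))
                  (p (n ∸ t)) (q (n ∸ t)) ⟩
      (M ⋆ σ) i t * p (n ∸ t) + (M ⋆ τ) i t * q (n ∸ t)
        ≡⟨ cong₂ (λ x y → x * p (n ∸ t) + y * q (n ∸ t)) (σ-eigen i t) (τ-shear i t) ⟩
      σ i * a t * p (n ∸ t) + (σ i * c t + τ i * onePS t) * q (n ∸ t)
        ≡⟨ solve 7 (λ s r x y o P Q →
             s :* x :* P :+ (s :* y :+ r :* o) :* Q := s :* (x :* P :+ y :* Q) :+ r :* (o :* Q))
             refl (σ i) (τ i) (a t) (c t) (onePS t) (p (n ∸ t)) (q (n ∸ t)) ⟩
      σ i * A t + τ i * (onePS t * q (n ∸ t)) ∎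

  σ-part : Fin 2 → ℕ → PS
  σ-part j zero = constPS (π j)
  σ-part j (suc m) = (a ⊛ σ-part j m) ⊕ (c ⊛ constPS (ρ j))

  column-^M : ∀ m j i → column (M ^M m) j i ≗ (σ ⊗ σ-part j m ⊕ᶜ τ ⊗ constPS (ρ j)) i
  column-^M zero j = idM-column j
  column-^M (suc m) j i n =
    trans (▹-cong M (column-^M m j) i n) (▹-triangular (σ-part j m) (constPS (ρ j)) i n)

record HalfBounded {M : Mat} (T : Triangularisation M) : Set where
  open Triangularisation T
  field
    ∣σ∣≤1 : ∀ i → ∣ σ i ∣ ≤ 1ℚ
    ∣τ∣≤1 : ∀ i → ∣ τ i ∣ ≤ 1ℚ
    ∣a∣≤½/k! : ∀ k → ∣ a k ∣ ≤ ½ * inv! k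
    ∣c∣≤½/k! : ∀ k → ∣ c k ∣ ≤ ½ * inv! k
    ∣π∣≤½ : ∀ j → ∣ π j ∣ ≤ ½
    ∣ρ∣≤½ : ∀ j → ∣ ρ j ∣ ≤ ½

module _ {M : Mat} {T : Triangularisation M} (B : HalfBounded T)
         {l : ℚ} (0≤l : 0ℚ ≤ l) (l≤log2 : ≤log2 l) where
  open Triangularisation T
  open HalfBounded B

  private
    ½e : PS
    ½e = scalePS ½ (expTerm l)

  σ-part-majorised : ∀ j m → Majorised l (σ-part T j m) envelope
  σ-part-majorised j zero = Majorised-mono (constPS-majorised (∣π∣≤½ j)) constPS-½≤envelope
  σ-part-majorised j (suc m) = Majorised-mono
    (⊕-majorised 0≤l
      (⊛-majorised 0≤l (expTerm-majorised 0≤l {½} ∣a∣≤½/k!) (σ-part-majorised j m))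
      (⊛-majorised 0≤l (expTerm-majorised 0≤l {½} ∣c∣≤½/k!) (constPS-majorised (∣ρ∣≤½ j))))
    (λ k → ≤-trans (≤-reflexive (sym (⊛-distribˡ-⊕ ½e envelope (constPS ½) k))) (envelope-step 0≤l l≤log2 k))

  column-majorised : ∀ m j i → Majorised l (column (M ^M m) j i) (envelope ⊕ constPS ½)
  column-majorised m j i = Majorised-resp-≗ (column-^M T m j i)
    (⊕-majorised 0≤l
      (scalePS-majorised 0≤l (∣σ∣≤1 i) (σ-part-majorised j m))
      (scalePS-majorised 0≤l (∣τ∣≤1 i) (constPS-majorised (∣ρ∣≤½ j))))
  ^M-coefficient-bound : ∀ m i j k → (M ^M m) i j (suc k) * l ^ℚ suc k ≤ + 2 / 1
  ^M-coefficient-bound m i j k = ≤-trans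
    (*-monoʳ-≤-nonNeg (l ^ℚ suc k) {{nonNegative (^ℚ-nonNeg 0≤l (suc k))}} (p≤∣p∣ ((M ^M m) i j (suc k))))
    (Majorised.bound (column-majorised m j i) (suc k))

½eˣ ½e⁻ˣ : PS
½eˣ k = ½ * (coshPS k + sinhPS k)
½e⁻ˣ k = ½ * (coshPS k - sinhPS k)

∣cosh+sinh∣ : ∀ k → ∣ coshPS k + sinhPS k ∣ ≡ inv! k
∣cosh+sinh∣ k with isEven k
... | true = trans (cong ∣_∣ (+-identityʳ (inv! k))) (0≤p⇒∣p∣≡p (inv!-nonNeg k))
... | false = trans (cong ∣_∣ (+-identityˡ (inv! k))) (0≤p⇒∣p∣≡p (inv!-nonNeg k))

∣cosh-sinh∣ : ∀ k → ∣ coshPS k - sinhPS k ∣ ≡ inv! k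
∣cosh-sinh∣ k with isEven k
... | true = trans (cong ∣_∣ (+-identityʳ (inv! k))) (0≤p⇒∣p∣≡p (inv!-nonNeg k))
... | false = trans (cong ∣_∣ (+-identityˡ (- inv! k))) (trans (∣-p∣≡∣p∣ (inv! k)) (0≤p⇒∣p∣≡p (inv!-nonNeg k)))

∣½eˣ∣ : ∀ k → ∣ ½eˣ k ∣ ≤ ½ * inv! k
∣½eˣ∣ k = ≤-reflexive (trans (∣p*q∣≡∣p∣*∣q∣ ½ (coshPS k + sinhPS k)) (cong (½ *_) (∣cosh+sinh∣ k)))

∣½e⁻ˣ∣ : ∀ k → ∣ ½e⁻ˣ k ∣ ≤ ½ * inv! k
∣½e⁻ˣ∣ k = ≤-reflexive (trans (∣p*q∣≡∣p∣*∣q∣ ½ (coshPS k - sinhPS k)) (cong (½ *_) (∣cosh-sinh∣ k)))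

M₀-triangularisation : Triangularisation M₀
M₀-triangularisation = record
  { σ = 1ℚ ∷ - 1ℚ ∷ []
  ; τ = 1ℚ ∷ 1ℚ ∷ []
  ; a = ½e⁻ˣ
  ; c = ½eˣ
  ; σ-eigen = λ
    { zero k → solve 3 (λ C S O →
        con ½ :* (C :+ O) :* con 1ℚ :+ con ½ :* (S :+ O) :* con (- 1ℚ)
          := con 1ℚ :* (con ½ :* (C :- S))) refl (coshPS k) (sinhPS k) (onePS k)
    ; (suc zero) k → solve 3 (λ C S O →
        con ½ :* (:- C :+ O) :* con 1ℚ :+ con ½ :* (:- S :+ O) :* con (- 1ℚ)
          := con (- 1ℚ) :* (con ½ :* (C :- S))) refl (coshPS k) (sinhPS k) (onePS k)
    }
  ; τ-shear = λ
    { zero k → solve 3 (λ C S O →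
        con ½ :* (C :+ O) :* con 1ℚ :+ con ½ :* (S :+ O) :* con 1ℚ
          := con 1ℚ :* (con ½ :* (C :+ S)) :+ con 1ℚ :* O) refl (coshPS k) (sinhPS k) (onePS k)
    ; (suc zero) k → solve 3 (λ C S O →
        con ½ :* (:- C :+ O) :* con 1ℚ :+ con ½ :* (:- S :+ O) :* con 1ℚ
          := con (- 1ℚ) :* (con ½ :* (C :+ S)) :+ con 1ℚ :* O) refl (coshPS k) (sinhPS k) (onePS k)
    }
  ; π = ½ ∷ - ½ ∷ []
  ; ρ = ½ ∷ ½ ∷ []
  ; idM-column = λ
    { zero zero zero → refl ; zero zero (suc _) → refl
    ; zero (suc zero) zero → refl ; zero (suc zero) (suc _) → refl
    ; (suc zero) zero zero → refl ; (suc zero) zero (suc _) → refl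
    ; (suc zero) (suc zero) zero → refl ; (suc zero) (suc zero) (suc _) → refl
    }
  }

M₁-triangularisation : Triangularisation M₁
M₁-triangularisation = record
  { σ = 1ℚ ∷ 1ℚ ∷ []
  ; τ = 1ℚ ∷ - 1ℚ ∷ []
  ; a = ½eˣ
  ; c = ½e⁻ˣ
  ; σ-eigen = λ
    { zero k → solve 3 (λ C S O →
        con ½ :* (C :+ O) :* con 1ℚ :+ con ½ :* (S :+ :- O) :* con 1ℚ
          := con 1ℚ :* (con ½ :* (C :+ S))) refl (coshPS k) (sinhPS k) (onePS k)
    ; (suc zero) k → solve 3 (λ C S O →
        con ½ :* (C :+ :- O) :* con 1ℚ :+ con ½ :* (S :+ O) :* con 1ℚ
          := con 1ℚ :* (con ½ :* (C :+ S))) refl (coshPS k) (sinhPS k) (onePS k)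
    }
  ; τ-shear = λ
    { zero k → solve 3 (λ C S O →
        con ½ :* (C :+ O) :* con 1ℚ :+ con ½ :* (S :+ :- O) :* con (- 1ℚ)
          := con 1ℚ :* (con ½ :* (C :- S)) :+ con 1ℚ :* O) refl (coshPS k) (sinhPS k) (onePS k)
    ; (suc zero) k → solve 3 (λ C S O →
        con ½ :* (C :+ :- O) :* con 1ℚ :+ con ½ :* (S :+ O) :* con (- 1ℚ)
          := con 1ℚ :* (con ½ :* (C :- S)) :+ con (- 1ℚ) :* O) refl (coshPS k) (sinhPS k) (onePS k)
    }
  ; π = ½ ∷ ½ ∷ []
  ; ρ = ½ ∷ - ½ ∷ []
  ; idM-column = λ
    { zero zero zero → refl ; zero zero (suc _) → refl
    ; zero (suc zero) zero → refl ; zero (suc zero) (suc _) → refl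
    ; (suc zero) zero zero → refl ; (suc zero) zero (suc _) → refl
    ; (suc zero) (suc zero) zero → refl ; (suc zero) (suc zero) (suc _) → refl
    }
  }

Mb-triangularisation : ∀ b → Triangularisation (Mb b)
Mb-triangularisation zero = M₀-triangularisation
Mb-triangularisation (suc zero) = M₁-triangularisation

Mb-halfBounded : ∀ b → HalfBounded (Mb-triangularisation b)
Mb-halfBounded zero = record
  { ∣σ∣≤1 = λ { zero → ≤-refl ; (suc zero) → ≤-refl }
  ; ∣τ∣≤1 = λ { zero → ≤-refl ; (suc zero) → ≤-refl }
  ; ∣a∣≤½/k! = ∣½e⁻ˣ∣
  ; ∣c∣≤½/k! = ∣½eˣ∣
  ; ∣π∣≤½ = λ { zero → ≤-refl ; (suc zero) → ≤-refl }
  ; ∣ρ∣≤½ = λ { zero → ≤-refl ; (suc zero) → ≤-refl }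
  }
Mb-halfBounded (suc zero) = record
  { ∣σ∣≤1 = λ { zero → ≤-refl ; (suc zero) → ≤-refl }
  ; ∣τ∣≤1 = λ { zero → ≤-refl ; (suc zero) → ≤-refl }
  ; ∣a∣≤½/k! = ∣½eˣ∣
  ; ∣c∣≤½/k! = ∣½e⁻ˣ∣
  ; ∣π∣≤½ = λ { zero → ≤-refl ; (suc zero) → ≤-refl }
  ; ∣ρ∣≤½ = λ { zero → ≤-refl ; (suc zero) → ≤-refl }
  }

lemma6 : (m : ℕ) → m ≥ 1 → (b i j : Fin 2) → (k : ℕ) → k ≥ 1 →
    (l : ℚ) → 0ℚ < l → ≤log2 l →
    ((Mb b ^M m) i j k) * (l ^ℚ k) ≤ (+ 2 / 1)
lemma6 m _ b i j (suc k) _ l 0<l l≤log2 =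
  ^M-coefficient-bound (Mb-halfBounded b) (<⇒≤ 0<l) l≤log2 m i j k
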